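{- Let $m\ge2$ be even and $n\ge1$. The map sending $M\in A(m,n)$ to the matrix $M^-$ formed by the first $m-1$ rows of $M$ is a bijection from $A(m,n)$ onto the set of matrices $N\in A(m-1,n)$ such that the sum of all entries of the row-sum vector of $N$ (equivalently, the sum of all entries of $N$) lies in $\{ -1,0,1\}$.
   Context: For positive integers $m,n$, let $A(m,n)$ be the set of all $m\times n$ matrices with every entry in $\{1,-1\}$ such that every row sum and every column sum has absolute value at most $1$. The row-sum vector of a matrix is the vector of its row sums. -}

module Defs where

open import Data.Nat using (ℕ; suc; _≤_)
open import Data.Integer using (ℤ; +_; -[1+_]; _+_; ∣_∣)
open import Data.Sign using (Sign)
open import Data.Vec using (Vec; map; foldr; init; zipWith; replicate)
open import Data.Product using (_×_)
open import Data.Vec.Relation.Unary.All using (All)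

Matrix : ℕ → ℕ → Set
Matrix m n = Vec (Vec Sign n) m

val : Sign → ℤ
val Sign.+ = + 1
val Sign.- = -[1+ 0 ]

sumℤ : ∀ {k} → Vec ℤ k → ℤ
sumℤ = foldr _ _+_ (+ 0)

rowSum : ∀ {n} → Vec Sign n → ℤ
rowSum r = sumℤ (map val r)

rowSums : ∀ {m n} → Matrix m n → Vec ℤ m
rowSums M = map rowSum M

colSums : ∀ {m n} → Matrix m n → Vec ℤ n
colSums {n = n} M = foldr _ (λ r acc → zipWith _+_ (map val r) acc) (replicate n (+ 0)) M

Small : ℤ → Set
Small x = ∣ x ∣ ≤ 1

InA : ∀ {m n} → Matrix m n → Set
InA M = All Small (rowSums M) × All Small (colSums M)

dropLast : ∀ {m n} → Matrix (suc m) n → Matrix m n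
dropLast = init

module Submission where

-- A column sum of a ±1 matrix with L rows has the parity of L.  Hence
-- for M = N ∷ʳ r ∈ A(m,n) (m even) every column sum is even and at most 1 in
-- absolute value, i.e. zero: the last row r is forced to be the negated column
-- sums of N ("r completes N").  Conversely, if N has an odd number of rows and
-- small column sums, these column sums are ±1, so their negation is a row of
-- signs completing N.  A completing row makes every column sum of N ∷ʳ r zero
-- and has row sum minus the total sum of N (total sum = sum of row sums = sum
-- of column sums), which gives the size condition on the total.

open import Defs
open import Data.Nat using (ℕ; suc; _≤_; _*_)
open import Data.Integer using (∣_∣)
open import Data.Product using (_×_; Σ; ∃; _,_)
open import Relation.Binary.PropositionalEquality using (_≡_)

open import Data.Nat.Base using (zero; z≤n; s≤s; parity)
open import Data.Integer.Base using (ℤ; +_; -[1+_]; _+_; -_)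
import Data.Integer.Properties as ℤ
open import Data.Sign using (Sign)
open import Data.Parity.Base using (Parity; 0ℙ; 1ℙ; _⁻¹)
open import Data.Parity.Properties using (suc-homo-⁻¹; ⁻¹-selfInverse; *-homo-*)
open import Data.Product using (proj₂)
open import Data.Vec using (Vec; []; _∷_; _∷ʳ_; map; zipWith; replicate; init; last; initLast)
open import Data.Vec.Properties using (∷-injective; map-∷ʳ; init-∷ʳ; zipWith-assoc; zipWith-identityˡ; zipWith-identityʳ; zipWith-inverseʳ)
open import Data.Vec.Relation.Unary.All using (All; []; _∷_; universal)
import Data.Vec.Relation.Unary.All as All
open import Data.Vec.Relation.Unary.All.Properties using (map⁺; map⁻)
open import Relation.Binary.PropositionalEquality using (refl; sym; trans; cong; cong₂; subst; module ≡-Reasoning)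
open import Algebra.Bundles using (AbelianGroup)
open import Algebra.Properties.Group (AbelianGroup.group ℤ.+-0-abelianGroup) using (inverseʳ-unique)
import Algebra.Properties.CommutativeSemigroup as CommSemigroupProperties
open CommSemigroupProperties ℤ.+-commutativeSemigroup using (interchange)

All-replicate : ∀ {A : Set} {P : A → Set} n {x} → P x → All P (replicate n x)
All-replicate zero    px = []
All-replicate (suc n) px = px ∷ All-replicate n px

All-∷ʳ⁺ : ∀ {A : Set} {P : A → Set} {n} {xs : Vec A n} {x} → All P xs → P x → All P (xs ∷ʳ x)
All-∷ʳ⁺ []         px = px ∷ []
All-∷ʳ⁺ (py ∷ pys) px = py ∷ All-∷ʳ⁺ pys px

All-∷ʳ⁻ : ∀ {A : Set} {P : A → Set} {n} (xs : Vec A n) {x} → All P (xs ∷ʳ x) → All P xs × P x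
All-∷ʳ⁻ []       (px ∷ [])  = [] , px
All-∷ʳ⁻ (y ∷ xs) (py ∷ pxs) with All-∷ʳ⁻ xs pxs
... | pys , px = py ∷ pys , px

init-∷ʳ-last : ∀ {A : Set} {m} (xs : Vec A (suc m)) → xs ≡ init xs ∷ʳ last xs
init-∷ʳ-last xs = proj₂ (proj₂ (initLast xs))

val-small : ∀ s → Small (val s)
val-small Sign.+ = s≤s z≤n
val-small Sign.- = s≤s z≤n

map-val-injective : ∀ {n} (r r′ : Vec Sign n) → map val r ≡ map val r′ → r ≡ r′
map-val-injective []      []        _  = refl
map-val-injective (s ∷ r) (s′ ∷ r′) eq with ∷-injective eq
... | head , tail = cong₂ _∷_ (val-injective s s′ head) (map-val-injective r r′ tail)
  where
    val-injective : ∀ s s′ → val s ≡ val s′ → s ≡ s′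
    val-injective Sign.+ Sign.+ _ = refl
    val-injective Sign.- Sign.- _ = refl

parityℤ : ℤ → Parity
parityℤ z = parity ∣ z ∣

HasParity : Parity → ℤ → Set
HasParity p z = parityℤ z ≡ p

parity-suc : ∀ n → parity (suc n) ≡ parity n ⁻¹
parity-suc n = sym (⁻¹-selfInverse (suc-homo-⁻¹ n))

parityℤ-flip : ∀ s z → parityℤ (val s + z) ≡ parityℤ z ⁻¹
parityℤ-flip Sign.+ (+ n)              = parity-suc n
parityℤ-flip Sign.+ -[1+ zero ]        = refl
parityℤ-flip Sign.+ -[1+ suc n ]       = parity-suc n
parityℤ-flip Sign.- (+ zero)           = refl
parityℤ-flip Sign.- (+ suc n)          = sym (suc-homo-⁻¹ n)
parityℤ-flip Sign.- -[1+ n ]           = sym (suc-homo-⁻¹ n)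

addRow-parity : ∀ {n p} (r : Vec Sign n) {c : Vec ℤ n} → All (HasParity p) c →
                All (HasParity (p ⁻¹)) (zipWith _+_ (map val r) c)
addRow-parity []      []       = []
addRow-parity (s ∷ r) {z ∷ _} (pz ∷ pc) = trans (parityℤ-flip s z) (cong _⁻¹ pz) ∷ addRow-parity r pc

colSums-parity : ∀ {L n} (M : Matrix L n) → All (HasParity (parity L)) (colSums M)
colSums-parity {n = n} []      = All-replicate n refl
colSums-parity {suc L} (r ∷ M) =
  subst (λ p → All (HasParity p) (colSums (r ∷ M))) (sym (parity-suc L)) (addRow-parity r (colSums-parity M))

small-even : ∀ z → HasParity 0ℙ z → Small z → z ≡ + 0
small-even (+ zero)        _  _         = refl
small-even (+ suc zero)    () _
small-even (+ suc (suc n)) _  (s≤s ())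
small-even -[1+ zero ]     () _
small-even -[1+ suc n ]    _  (s≤s ())

small-odd : ∀ z → HasParity 1ℙ z → Small z → ∃ λ s → val s ≡ - z
small-odd (+ zero)        () _
small-odd (+ suc zero)    _  _        = Sign.- , refl
small-odd (+ suc (suc n)) _  (s≤s ())
small-odd -[1+ zero ]     _  _        = Sign.+ , refl
small-odd -[1+ suc n ]    _  (s≤s ())

sumℤ-zipWith : ∀ {n} (u v : Vec ℤ n) → sumℤ (zipWith _+_ u v) ≡ sumℤ u + sumℤ v
sumℤ-zipWith []      []      = refl
sumℤ-zipWith (a ∷ u) (b ∷ v) = trans (cong (_+_ (a + b)) (sumℤ-zipWith u v)) (interchange a b (sumℤ u) (sumℤ v))

sumℤ-neg : ∀ {n} (u : Vec ℤ n) → sumℤ (map -_ u) ≡ - sumℤ u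
sumℤ-neg []      = refl
sumℤ-neg (a ∷ u) = trans (cong (_+_ (- a)) (sumℤ-neg u)) (sym (ℤ.neg-distrib-+ a (sumℤ u)))

sumℤ-zeros : ∀ n → sumℤ (replicate n (+ 0)) ≡ + 0
sumℤ-zeros zero    = refl
sumℤ-zeros (suc n) = cong (_+_ (+ 0)) (sumℤ-zeros n)

total-by-columns : ∀ {m n} (M : Matrix m n) → sumℤ (rowSums M) ≡ sumℤ (colSums M)
total-by-columns {n = n} [] = sym (sumℤ-zeros n)
total-by-columns (r ∷ M) =
  trans (cong (_+_ (rowSum r)) (total-by-columns M)) (sym (sumℤ-zipWith (map val r) (colSums M)))

colSums-∷ʳ : ∀ {m n} (N : Matrix m n) (r : Vec Sign n) → colSums (N ∷ʳ r) ≡ zipWith _+_ (colSums N) (map val r)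
colSums-∷ʳ []      r = trans (zipWith-identityʳ ℤ.+-identityʳ (map val r)) (sym (zipWith-identityˡ ℤ.+-identityˡ (map val r)))
colSums-∷ʳ (s ∷ N) r =
  trans (cong (zipWith _+_ (map val s)) (colSums-∷ʳ N r)) (sym (zipWith-assoc ℤ.+-assoc (map val s) (colSums N) (map val r)))

Completes : ∀ {m n} → Matrix m n → Vec Sign n → Set
Completes N r = map val r ≡ map -_ (colSums N)

completes-colSums : ∀ {m n} (N : Matrix m n) {r} → Completes N r → colSums (N ∷ʳ r) ≡ replicate n (+ 0)
completes-colSums N {r} completes = begin
  colSums (N ∷ʳ r)                                ≡⟨ colSums-∷ʳ N r ⟩
  zipWith _+_ (colSums N) (map val r)             ≡⟨ cong (zipWith _+_ (colSums N)) completes ⟩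
  zipWith _+_ (colSums N) (map -_ (colSums N))    ≡⟨ zipWith-inverseʳ ℤ.+-inverseʳ (colSums N) ⟩
  replicate _ (+ 0)                               ∎
  where open ≡-Reasoning

completes-rowSum : ∀ {m n} (N : Matrix m n) {r} → Completes N r → rowSum r ≡ - sumℤ (rowSums N)
completes-rowSum N {r} completes = begin
  sumℤ (map val r)             ≡⟨ cong sumℤ completes ⟩
  sumℤ (map -_ (colSums N))    ≡⟨ sumℤ-neg (colSums N) ⟩
  - sumℤ (colSums N)           ≡⟨ cong -_ (total-by-columns N) ⟨
  - sumℤ (rowSums N)           ∎
  where open ≡-Reasoning

completes-∣rowSum∣ : ∀ {m n} (N : Matrix m n) {r} → Completes N r → ∣ rowSum r ∣ ≡ ∣ sumℤ (rowSums N) ∣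
completes-∣rowSum∣ N completes =
  trans (cong ∣_∣ (completes-rowSum N completes)) (ℤ.∣-i∣≡∣i∣ (sumℤ (rowSums N)))

-- A completable matrix has small column sums, as they are negated signs.
completes-colSmall : ∀ {m n} (N : Matrix m n) {r} → Completes N r → All Small (colSums N)
completes-colSmall N {r} completes =
  All.map (λ {z} → subst (_≤ 1) (ℤ.∣-i∣≡∣i∣ z)) (map⁻ (subst (All Small) completes (map⁺ (universal val-small r))))

completes-unique : ∀ {m n} (N : Matrix m n) {r r′} → Completes N r → Completes N r′ → r ≡ r′
completes-unique N {r} {r′} c c′ = map-val-injective r r′ (trans c (sym c′))

cancelling-completes : ∀ {n} (c : Vec ℤ n) (r : Vec Sign n) →
                       All (_≡ + 0) (zipWith _+_ c (map val r)) → map val r ≡ map -_ c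
cancelling-completes []      []      []         = refl
cancelling-completes (z ∷ c) (s ∷ r) (e ∷ es) = cong₂ _∷_ (inverseʳ-unique z (val s) e) (cancelling-completes c r es)

negated-signs-complete : ∀ {n} (c : Vec ℤ n) → All (λ z → ∃ λ s → val s ≡ - z) c →
                         ∃ λ r → map val r ≡ map -_ c
negated-signs-complete []      []              = [] , refl
negated-signs-complete (z ∷ c) ((s , e) ∷ es) with negated-signs-complete c es
... | r , eq = s ∷ r , cong₂ _∷_ e eq

module OddRows {m : ℕ} (odd : parity m ≡ 1ℙ) where

  even : parity (suc m) ≡ 0ℙ
  even = trans (parity-suc m) (cong _⁻¹ odd)

  lastRow-completes : ∀ {n} (N : Matrix m n) r → InA (N ∷ʳ r) → Completes N r
  lastRow-completes N r (_ , colsSmall) = cancelling-completes (colSums N) r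
    (subst (All (_≡ + 0)) (colSums-∷ʳ N r)
      (All.map (λ {z} (hasParity , small) → small-even z (trans hasParity even) small)
        (All.zip (colSums-parity (N ∷ʳ r) , colsSmall))))

  restriction-lands : ∀ {n} (N : Matrix m n) r → InA (N ∷ʳ r) → InA N × ∣ sumℤ (rowSums N) ∣ ≤ 1
  restriction-lands N r A@(rowsSmall , _) with All-∷ʳ⁻ (rowSums N) (subst (All Small) (map-∷ʳ rowSum r N) rowsSmall)
  ... | rowsSmallN , lastSmall = (rowsSmallN , completes-colSmall N completes) , totalSmall
    where
      completes : Completes N r
      completes = lastRow-completes N r A
      totalSmall : ∣ sumℤ (rowSums N) ∣ ≤ 1
      totalSmall = subst (_≤ 1) (completes-∣rowSum∣ N completes) lastSmall

  determined-by-init : ∀ {n} (M M′ : Matrix (suc m) n) → InA M → InA M′ → init M ≡ init M′ → M ≡ M′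
  determined-by-init M M′ A A′ same = begin
    M                   ≡⟨ init-∷ʳ-last M ⟩
    init M ∷ʳ last M    ≡⟨ cong₂ _∷ʳ_ same (completes-unique (init M′) completes completes′) ⟩
    init M′ ∷ʳ last M′  ≡⟨ init-∷ʳ-last M′ ⟨
    M′                  ∎
    where
      open ≡-Reasoning
      completes : Completes (init M′) (last M)
      completes = subst (λ N → Completes N (last M)) same
                    (lastRow-completes (init M) (last M) (subst InA (init-∷ʳ-last M) A))
      completes′ : Completes (init M′) (last M′)
      completes′ = lastRow-completes (init M′) (last M′) (subst InA (init-∷ʳ-last M′) A′)

  -- Since m is odd, the small column sums of N are ±1, so N has a completing row.
  completion-exists : ∀ {n} (N : Matrix m n) → All Small (colSums N) → ∃ λ r → Completes N r
  completion-exists N colsSmall = negated-signs-complete (colSums N)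
    (All.map (λ {z} (hasParity , small) → small-odd z (trans hasParity odd) small)
      (All.zip (colSums-parity N , colsSmall)))

  extension-exists : ∀ {n} (N : Matrix m n) → InA N → ∣ sumℤ (rowSums N) ∣ ≤ 1 →
                     Σ (Matrix (suc m) n) λ M → InA M × init M ≡ N
  extension-exists {n} N (rowsSmall , colsSmall) totalSmall with completion-exists N colsSmall
  ... | r , completes = N ∷ʳ r , (rows , cols) , init-∷ʳ r N
    where
      lastSmall : Small (rowSum r)
      lastSmall = subst (_≤ 1) (sym (completes-∣rowSum∣ N completes)) totalSmall
      rows : All Small (rowSums (N ∷ʳ r))
      rows = subst (All Small) (sym (map-∷ʳ rowSum r N)) (All-∷ʳ⁺ rowsSmall lastSmall)
      cols : All Small (colSums (N ∷ʳ r))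
      cols = subst (All Small) (sym (completes-colSums N completes)) (All-replicate n z≤n)

corollary1 : (k n : ℕ) → 1 ≤ k → 1 ≤ n →
    (m' : ℕ) → suc m' ≡ 2 * k →
      ((M : Matrix (suc m') n) → InA M →
         InA (dropLast M) × ∣ sumℤ (rowSums (dropLast M)) ∣ ≤ 1)
      × ((M M′ : Matrix (suc m') n) → InA M → InA M′ →
         dropLast M ≡ dropLast M′ → M ≡ M′)
      × ((N : Matrix m' n) → InA N → ∣ sumℤ (rowSums N) ∣ ≤ 1 →
         Σ (Matrix (suc m') n) λ M → InA M × dropLast M ≡ N)
corollary1 k n _ _ m' m≡2k = lands , determined-by-init , extension-exists
  where
    evenRows : parity (suc m') ≡ 0ℙ
    evenRows = trans (cong parity m≡2k) (*-homo-* 2 k)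
    oddRows : parity m' ≡ 1ℙ
    oddRows = trans (sym (suc-homo-⁻¹ m')) (cong _⁻¹ evenRows)
    open OddRows {m'} oddRows
    lands : (M : Matrix (suc m') n) → InA M → InA (dropLast M) × ∣ sumℤ (rowSums (dropLast M)) ∣ ≤ 1
    lands M A = restriction-lands (init M) (last M) (subst InA (init-∷ʳ-last M) A)
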